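{- Let $G$ be a multigraph (multiple edges allowed, no loops) with list chromatic index $\mathrm{ch}'(G)$, let $k$ be a positive integer, and let the palette be $\mathcal{K}=\{1,2,\dots,\mathrm{ch}'(G)+k\}$. Let $S\subseteq E(G)$ be a set of edges carrying a proper edge-colouring with colours from $\mathcal{K}$, such that every edge of $E(G)\setminus S$ is adjacent to (i.e., shares an end-vertex with) at most $k$ edges of $S$. Then this precolouring can be extended to a proper edge-colouring of all of $G$ using only colours from $\mathcal{K}$.
   Context: A proper edge-colouring assigns colours to edges so that any two edges sharing an end-vertex (including parallel edges) receive distinct colours. The list chromatic index $\mathrm{ch}'(G)$ is the least $m$ such that for every assignment of lists of at least $m$ colours to the edges, there is a proper edge-colouring in which each edge gets a colour from its list. Extending a precolouring means producing a proper edge-colouring of all of $G$ agreeing with the given colours on $S$. -}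

module Defs where

open import Data.Nat using (ℕ; _≤_; _<_; suc)
open import Data.Fin using (Fin)
open import Data.Fin.Properties using (_≟_)
open import Data.Fin.Subset using (Subset; _∈_; _∉_)
open import Data.Fin.Subset.Properties using (_∈?_)
open import Data.List using (List; length; filter; allFin)
open import Data.List.Relation.Unary.Unique.Propositional using (Unique)
import Data.List.Membership.Propositional as LM
open import Data.Product using (Σ; _×_; ∃)
open import Data.Sum using (_⊎_)
open import Relation.Nullary using (¬_; Dec)
open import Relation.Nullary.Decidable using (_×-dec_; _⊎-dec_; ¬?)
open import Relation.Binary.PropositionalEquality using (_≡_; _≢_)

-- A finite loopless multigraph: vertices Fin n, edges Fin m (so parallel
-- edges are distinct edge labels with the same ends), each edge has two
-- distinct end-vertices.
record Multigraph : Set where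
  field
    n   : ℕ
    m   : ℕ
    end₁ : Fin m → Fin n
    end₂ : Fin m → Fin n
    loopless : ∀ e → end₁ e ≢ end₂ e
open Multigraph public

ShareEnd : (G : Multigraph) → Fin (m G) → Fin (m G) → Set
ShareEnd G e f =
  (end₁ G e ≡ end₁ G f ⊎ end₁ G e ≡ end₂ G f) ⊎
  (end₂ G e ≡ end₁ G f ⊎ end₂ G e ≡ end₂ G f)

shareEnd? : (G : Multigraph) → (e f : Fin (m G)) → Dec (ShareEnd G e f)
shareEnd? G e f =
  ((end₁ G e ≟ end₁ G f) ⊎-dec (end₁ G e ≟ end₂ G f)) ⊎-dec
  ((end₂ G e ≟ end₁ G f) ⊎-dec (end₂ G e ≟ end₂ G f))

Adjacent : (G : Multigraph) → Fin (m G) → Fin (m G) → Set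
Adjacent G e f = e ≢ f × ShareEnd G e f

adjacent? : (G : Multigraph) → (e f : Fin (m G)) → Dec (Adjacent G e f)
adjacent? G e f = ¬? (e ≟ f) ×-dec shareEnd? G e f

EdgeColouring : Multigraph → Set
EdgeColouring G = Fin (m G) → ℕ

Proper : (G : Multigraph) → EdgeColouring G → Set
Proper G φ = ∀ e f → Adjacent G e f → φ e ≢ φ f

-- proper on the edge set S (a colouring of S; values outside S irrelevant)
ProperOn : (G : Multigraph) → Subset (m G) → EdgeColouring G → Set
ProperOn G S φ = ∀ e f → e ∈ S → f ∈ S → Adjacent G e f → φ e ≢ φ f

ListAssignment : Multigraph → Set
ListAssignment G = Fin (m G) → List ℕ

ListsOfSizeAtLeast : (G : Multigraph) → ℕ → ListAssignment G → Set
ListsOfSizeAtLeast G c L = ∀ e → Unique (L e) × c ≤ length (L e)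

EdgeChoosable : Multigraph → ℕ → Set
EdgeChoosable G c =
  (L : ListAssignment G) → ListsOfSizeAtLeast G c L →
  Σ (EdgeColouring G) λ φ → Proper G φ × (∀ e → φ e LM.∈ L e)

IsListChromaticIndex : Multigraph → ℕ → Set
IsListChromaticIndex G c =
  EdgeChoosable G c × (∀ c' → c' < c → ¬ EdgeChoosable G c')

InPalette : ℕ → ℕ → Set
InPalette p x = 1 ≤ x × x ≤ p

adjInS : (G : Multigraph) → Subset (m G) → Fin (m G) → ℕ
adjInS G S e = length (filter (λ f → (f ∈? S) ×-dec adjacent? G e f) (allFin (m G)))

module Submission where

-- Give every uncoloured edge e the list of palette colours not already used on
-- the edges of S adjacent to e, and give every edge of S the whole palette.
-- The palette has ch'(G) + k colours and e sees at most k of them on S, so every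
-- list has at least ch'(G) colours and G has a proper colouring from these lists.
-- Keeping that colouring off S and the precolouring on S is still proper, since
-- the lists forbid exactly the conflicts across S and its complement.

open import Defs
open import Data.Nat using (ℕ; _≤_; _+_; _≥_; suc; s≤s; z≤n)
open import Data.Nat.Properties as ℕ using (≤-refl; m≤m+n; +-monoʳ-≤; +-suc)
open import Data.Fin using (Fin)
open import Data.Fin.Subset using (Subset; _∈_; _∉_)
open import Data.Fin.Subset.Properties using (_∈?_)
open import Data.Product using (Σ; _×_; _,_; proj₁; proj₂)
open import Data.Sum using (inj₁; inj₂)
open import Data.List using (List; []; _∷_; length; filter; map; upTo; allFin; foldr)
open import Data.List.Properties using (filter-all; length-map; length-upTo)
open import Data.List.Relation.Unary.All as All using (All; []; _∷_)
open import Data.List.Relation.Unary.Unique.Propositional using (Unique; []; _∷_)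
import Data.List.Relation.Unary.Unique.Propositional.Properties as Unique
import Data.List.Membership.Propositional as List
import Data.List.Membership.Propositional.Properties as List
open import Data.Empty using (⊥-elim)
open import Function using (_∘_)
open import Relation.Nullary using (yes; no)
open import Relation.Nullary.Decidable using (¬?; _×-dec_)
open import Relation.Binary.Definitions using (DecidableEquality)
open import Relation.Binary.PropositionalEquality using (_≡_; _≢_; refl; sym; trans; cong; subst)

module ListRemoval {A : Set} (_≟_ : DecidableEquality A) where

  remove : A → List A → List A
  remove y = filter (¬? ∘ (y ≟_))

  removeAll : List A → List A → List A
  removeAll ys xs = foldr remove xs ys

  length-remove : ∀ y {xs} → Unique xs → length xs ≤ suc (length (remove y xs))
  length-remove y {[]} [] = z≤n
  length-remove y {x ∷ xs} (x∉xs ∷ u) with y ≟ x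
  ... | yes refl rewrite filter-all (¬? ∘ (y ≟_)) x∉xs = s≤s ≤-refl
  ... | no  _    = s≤s (length-remove y u)

  Unique-removeAll : ∀ ys {xs} → Unique xs → Unique (removeAll ys xs)
  Unique-removeAll []       u = u
  Unique-removeAll (y ∷ ys) u = Unique.filter⁺ (¬? ∘ (y ≟_)) (Unique-removeAll ys u)

  length-removeAll : ∀ ys {xs} → Unique xs → length xs ≤ length ys + length (removeAll ys xs)
  length-removeAll []       u = ≤-refl
  length-removeAll (y ∷ ys) {xs} u = begin
    length xs                                        ≤⟨ length-removeAll ys u ⟩
    length ys + length (removeAll ys xs)             ≤⟨ +-monoʳ-≤ (length ys) (length-remove y (Unique-removeAll ys u)) ⟩
    length ys + suc (length (removeAll (y ∷ ys) xs)) ≡⟨ +-suc (length ys) _ ⟩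
    suc (length ys + length (removeAll (y ∷ ys) xs)) ∎
    where open ℕ.≤-Reasoning

  ∈-removeAll⁻ : ∀ ys {xs x} → x List.∈ removeAll ys xs → x List.∈ xs × All (_≢ x) ys
  ∈-removeAll⁻ []       x∈ = x∈ , []
  ∈-removeAll⁻ (y ∷ ys) x∈ with List.∈-filter⁻ (¬? ∘ (y ≟_)) x∈
  ... | x∈′ , y≢x with ∈-removeAll⁻ ys x∈′
  ... | x∈xs , ys≢x = x∈xs , y≢x ∷ ys≢x

open ListRemoval ℕ._≟_

palette : ℕ → List ℕ
palette p = map suc (upTo p)

Unique-palette : ∀ p → Unique (palette p)
Unique-palette p = Unique.map⁺ (λ { refl → refl }) (Unique.upTo⁺ p)

length-palette : ∀ p → length (palette p) ≡ p
length-palette p = trans (length-map suc (upTo p)) (length-upTo p)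

∈-palette⁻ : ∀ p {x} → x List.∈ palette p → InPalette p x
∈-palette⁻ p x∈ with List.∈-map⁻ suc x∈
... | _ , i∈ , refl = s≤s z≤n , List.∈-upTo⁻ i∈

ShareEnd-sym : ∀ G {e f} → ShareEnd G e f → ShareEnd G f e
ShareEnd-sym G (inj₁ (inj₁ q)) = inj₁ (inj₁ (sym q))
ShareEnd-sym G (inj₁ (inj₂ q)) = inj₂ (inj₁ (sym q))
ShareEnd-sym G (inj₂ (inj₁ q)) = inj₁ (inj₂ (sym q))
ShareEnd-sym G (inj₂ (inj₂ q)) = inj₂ (inj₂ (sym q))

Adjacent-sym : ∀ G {e f} → Adjacent G e f → Adjacent G f e
Adjacent-sym G (e≢f , share) = e≢f ∘ sym , ShareEnd-sym G share

module Extension (G : Multigraph) (S : Subset (m G)) (pre : EdgeColouring G) (p : ℕ) where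

  neighboursInS : Fin (m G) → List (Fin (m G))
  neighboursInS e = filter (λ f → (f ∈? S) ×-dec adjacent? G e f) (allFin (m G))

  neighbourColours : Fin (m G) → List ℕ
  neighbourColours e = map pre (neighboursInS e)

  length-neighbourColours : ∀ e → length (neighbourColours e) ≡ adjInS G S e
  length-neighbourColours e = length-map pre (neighboursInS e)

  ∈-neighbourColours : ∀ {e f} → f ∈ S → Adjacent G e f → pre f List.∈ neighbourColours e
  ∈-neighbourColours {e} {f} f∈S adj =
    List.∈-map⁺ pre (List.∈-filter⁺ (λ f → (f ∈? S) ×-dec adjacent? G e f) (List.∈-allFin f) (f∈S , adj))

  availableColours : ListAssignment G
  availableColours e with e ∈? S
  ... | yes _ = palette p
  ... | no  _ = removeAll (neighbourColours e) (palette p)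

  availableColours-size : ∀ {c} → c ≤ p → (∀ e → e ∉ S → c + adjInS G S e ≤ p) →
                          ListsOfSizeAtLeast G c availableColours
  availableColours-size {c} c≤p room e with e ∈? S
  ... | yes _   = Unique-palette p , subst (c ≤_) (sym (length-palette p)) c≤p
  ... | no  e∉S = Unique-removeAll (neighbourColours e) (Unique-palette p) ,
                  ℕ.+-cancelˡ-≤ (length (neighbourColours e)) c _ (begin
    length (neighbourColours e) + c ≡⟨ ℕ.+-comm _ c ⟩
    c + length (neighbourColours e) ≡⟨ cong (c +_) (length-neighbourColours e) ⟩
    c + adjInS G S e                ≤⟨ room e e∉S ⟩
    p                               ≡⟨ sym (length-palette p) ⟩
    length (palette p)              ≤⟨ length-removeAll (neighbourColours e) (Unique-palette p) ⟩
    length (neighbourColours e) + length (removeAll (neighbourColours e) (palette p)) ∎)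
    where open ℕ.≤-Reasoning

  ∈-availableColours⁻ : ∀ {e x} → e ∉ S → x List.∈ availableColours e →
                        x List.∈ palette p × All (_≢ x) (neighbourColours e)
  ∈-availableColours⁻ {e} e∉S x∈ with e ∈? S
  ... | yes e∈S = ⊥-elim (e∉S e∈S)
  ... | no  _   = ∈-removeAll⁻ (neighbourColours e) x∈

  splice : EdgeColouring G → EdgeColouring G
  splice ψ e with e ∈? S
  ... | yes _ = pre e
  ... | no  _ = ψ e

  splice-agrees : ∀ ψ e → e ∈ S → splice ψ e ≡ pre e
  splice-agrees ψ e e∈S with e ∈? S
  ... | yes _   = refl
  ... | no  e∉S = ⊥-elim (e∉S e∈S)

  module _ (ψ : EdgeColouring G) (ψ-from-lists : ∀ e → ψ e List.∈ availableColours e) where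

    avoids-precolouring : ∀ {e f} → e ∉ S → f ∈ S → Adjacent G e f → pre f ≢ ψ e
    avoids-precolouring e∉S f∈S adj =
      All.lookup (proj₂ (∈-availableColours⁻ e∉S (ψ-from-lists _))) (∈-neighbourColours f∈S adj)

    splice-proper : ProperOn G S pre → Proper G ψ → Proper G (splice ψ)
    splice-proper pre-proper ψ-proper e f adj with e ∈? S | f ∈? S
    ... | yes e∈S | yes f∈S = pre-proper e f e∈S f∈S adj
    ... | yes e∈S | no  f∉S = avoids-precolouring f∉S e∈S (Adjacent-sym G adj)
    ... | no  e∉S | yes f∈S = avoids-precolouring e∉S f∈S adj ∘ sym
    ... | no  _   | no  _   = ψ-proper e f adj

    splice-inPalette : (∀ e → e ∈ S → InPalette p (pre e)) → ∀ e → InPalette p (splice ψ e)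
    splice-inPalette pre-inPalette e with e ∈? S
    ... | yes e∈S = pre-inPalette e e∈S
    ... | no  e∉S = ∈-palette⁻ p (proj₁ (∈-availableColours⁻ e∉S (ψ-from-lists e)))

proposition1p3 : (G : Multigraph) (c : ℕ) → IsListChromaticIndex G c →
    (k : ℕ) → k ≥ 1 →
    (S : Subset (m G)) (pre : EdgeColouring G) →
    (∀ e → e ∈ S → InPalette (c + k) (pre e)) →
    ProperOn G S pre →
    (∀ e → e ∉ S → adjInS G S e ≤ k) →
    Σ (EdgeColouring G) λ φ →
    Proper G φ × (∀ e → InPalette (c + k) (φ e)) × (∀ e → e ∈ S → φ e ≡ pre e)
proposition1p3 G c (choosable , _) k _ S pre pre-inPalette pre-proper fewNeighbours =
  splice ψ ,
  splice-proper ψ ψ-from-lists pre-proper ψ-proper ,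
  splice-inPalette ψ ψ-from-lists pre-inPalette ,
  splice-agrees ψ
  where
  open Extension G S pre (c + k)
  listsLargeEnough : ListsOfSizeAtLeast G c availableColours
  listsLargeEnough = availableColours-size (m≤m+n c k) (λ e e∉S → +-monoʳ-≤ c (fewNeighbours e e∉S))
  ψ : EdgeColouring G
  ψ = proj₁ (choosable availableColours listsLargeEnough)
  ψ-proper : Proper G ψ
  ψ-proper = proj₁ (proj₂ (choosable availableColours listsLargeEnough))
  ψ-from-lists : ∀ e → ψ e List.∈ availableColours e
  ψ-from-lists = proj₂ (proj₂ (choosable availableColours listsLargeEnough))
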